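{- Let $(\mathcal R,X,\mathcal N)$ be a digit system having the finite expansion property. Then $(\mathcal R,X,\mathcal N)$ has a zero cycle, i.e. there exist $\ell\ge 0$ and $d_0,\dots,d_\ell\in\mathcal N$ with $0=\sum_{i=0}^{\ell}d_iX^i$ in $\mathcal R$.
   Context: Let $\mathcal E$ be a commutative ring with identity, $d\ge 1$, and $P(x)=p_dx^d+\dots+p_1x+p_0\in\mathcal E[x]$ such that $p_d$ and $p_0$ are not zero divisors of $\mathcal E$ and $\mathcal E/(p_0)$ is finite. Let $\mathcal R=\mathcal E[x]/(P)$ and let $X$ be the image of $x$ in $\mathcal R$. Let $\mathcal N\subset\mathcal R$ be a system of coset representatives of $\mathcal R/(X)$; $(\mathcal R,X,\mathcal N)$ is called a digit system. For $A\in\mathcal R$, $D_{\mathcal N}(A)$ is the unique $e\in\mathcal N$ with $A\equiv e\pmod X$ and $T(A)=\frac{A-D_{\mathcal N}(A)}{X}$ (the unique $B$ with $XB=A-D_{\mathcal N}(A)$). The digit system has the finite expansion property (FEP) if for every $A\in\mathcal R$ there is $n\in\mathbb N$ with $T^n(A)=0$. A zero cycle is a finite sequence $(d_0,\dots,d_\ell)$, $\ell\ge0$, $d_i\in\mathcal N$, with $0=\sum_{i=0}^\ell d_iX^i$ (this is distinct from the trivial empty-sum expansion of $0$). -}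

module Defs where

open import Level using (Level; _⊔_)
open import Algebra.Bundles using (CommutativeRing)
open import Data.Nat using (ℕ)
open import Data.Fin using (Fin)
open import Data.List using (List; []; _∷_; _++_; map)
open import Data.List.Relation.Unary.All using (All)
open import Data.Product using (Σ; _×_; ∃; ∃-syntax; proj₁; proj₂)
open import Data.Unit.Polymorphic using (⊤)
open import Function using (_∘_)

module DigitSystems {c ℓ : Level} (𝓔 : CommutativeRing c ℓ) where
  open CommutativeRing 𝓔

  NonZeroDivisor : Carrier → Set (c ⊔ ℓ)
  NonZeroDivisor p = ∀ y → p * y ≈ 0# → y ≈ 0#

  FiniteQuotient : Carrier → Set (c ⊔ ℓ)
  FiniteQuotient p = ∃[ n ] Σ (Fin n → Carrier) λ f →
    ∀ e → ∃[ i ] ∃[ y ] (e - f i ≈ p * y)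

  -- Polynomials in 𝓔[x] as coefficient lists (lowest degree first).
  Poly : Set c
  Poly = List Carrier

  _≈ₚ_ : Poly → Poly → Set ℓ
  [] ≈ₚ [] = ⊤
  [] ≈ₚ (b ∷ bs) = (b ≈ 0#) × ([] ≈ₚ bs)
  (a ∷ as) ≈ₚ [] = (a ≈ 0#) × (as ≈ₚ [])
  (a ∷ as) ≈ₚ (b ∷ bs) = (a ≈ b) × (as ≈ₚ bs)

  infixl 6 _+ₚ_ _-ₚ_
  infixl 7 _*ₚ_

  _+ₚ_ : Poly → Poly → Poly
  [] +ₚ q = q
  (a ∷ p) +ₚ [] = a ∷ p
  (a ∷ p) +ₚ (b ∷ q) = (a + b) ∷ (p +ₚ q)

  -ₚ_ : Poly → Poly
  -ₚ p = map -_ p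

  _-ₚ_ : Poly → Poly → Poly
  p -ₚ q = p +ₚ (-ₚ q)

  _*ₚ_ : Poly → Poly → Poly
  [] *ₚ q = []
  (a ∷ p) *ₚ q = map (a *_) q +ₚ (0# ∷ (p *ₚ q))

  xₚ : Poly
  xₚ = 0# ∷ 1# ∷ []

  -- The setting for a fixed P = p₀ + p₁x + … + p_d x^d, given as
  -- p₀ ∷ (p₁ … p_{d-1}) ++ [p_d]; hence d = length mid + 1 ≥ 1.
  module Over (p₀ : Carrier) (mid : List Carrier) (p_d : Carrier) where

    P : Poly
    P = p₀ ∷ (mid ++ (p_d ∷ []))

    -- 𝓡 = 𝓔[x]/(P): elements are polynomials, equality is congruence mod P.
    _≈ᵣ_ : Poly → Poly → Set (c ⊔ ℓ)
    A ≈ᵣ B = ∃[ Q ] ((A -ₚ B) ≈ₚ (Q *ₚ P))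

    X : Poly
    X = xₚ

    _≡modX_ : Poly → Poly → Set (c ⊔ ℓ)
    A ≡modX B = ∃[ C ] ((A -ₚ B) ≈ᵣ (X *ₚ C))

    -- 𝓝 is a complete system of coset representatives of 𝓡/(X):
    -- every A is congruent mod X to a digit (with witness B, X·B = A − e),
    -- and two digits congruent mod X are equal in 𝓡.
    record IsDigitSet (𝓝 : Poly → Set (c ⊔ ℓ)) : Set (c ⊔ ℓ) where
      field
        digit  : ∀ A → Σ Poly λ e → 𝓝 e × (Σ Poly λ B → (X *ₚ B) ≈ᵣ (A -ₚ e))
        unique : ∀ e e′ → 𝓝 e → 𝓝 e′ → e ≡modX e′ → e ≈ᵣ e′

      D : Poly → Poly
      D A = proj₁ (digit A)

      -- T(A) = (A − D_𝓝(A)) / X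
      T : Poly → Poly
      T A = proj₁ (proj₂ (proj₂ (digit A)))

      Tⁿ : ℕ → Poly → Poly
      Tⁿ ℕ.zero A = A
      Tⁿ (ℕ.suc n) A = Tⁿ n (T A)

    FEP : {𝓝 : Poly → Set (c ⊔ ℓ)} → IsDigitSet 𝓝 → Set (c ⊔ ℓ)
    FEP ds = ∀ A → ∃[ n ] (IsDigitSet.Tⁿ ds n A ≈ᵣ [])

    evalDigits : List Poly → Poly
    evalDigits [] = []
    evalDigits (d ∷ ds) = d +ₚ (X *ₚ evalDigits ds)

    -- A zero cycle: (d₀,…,d_ℓ), ℓ ≥ 0 (nonempty), digits in 𝓝, Σ dᵢ Xⁱ = 0 in 𝓡.
    HasZeroCycle : (Poly → Set (c ⊔ ℓ)) → Set (c ⊔ ℓ)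
    HasZeroCycle 𝓝 = ∃[ d₀ ] ∃[ ds ] (All 𝓝 (d₀ ∷ ds) × (evalDigits (d₀ ∷ ds) ≈ᵣ []))

module Submission where

-- Idea (as in the paper): expand 0 itself.  One step of the digit map gives
-- 0 = D(0) + X·T(0), and by the finite expansion property T(0) has a finite
-- expansion T(0) = Σ_{i<n} dᵢ Xⁱ.  Hence 0 = D(0) + Σ_{i<n} dᵢ X^{i+1}: the
-- digit sequence (D(0), d₀, …, d_{n-1}) is nonempty and sums to 0, i.e. it is
-- a zero cycle.

open import Defs
open import Level using (Level; _⊔_)
open import Algebra.Bundles using (CommutativeRing)
open import Data.List using (List; []; _∷_; map)
open import Data.List.Relation.Unary.All using (All; []; _∷_)
open import Data.Nat using (ℕ; zero; suc)
open import Data.Product using (∃-syntax; proj₁; proj₂; _,_)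
open import Data.Unit.Polymorphic using (tt)
open import Function using (_∘_)
import Algebra.Properties.AbelianGroup as AbelianGroupProperties
import Algebra.Properties.CommutativeSemigroup as CommutativeSemigroupProperties
import Algebra.Properties.Ring as RingProperties
import Relation.Binary.Reasoning.Setoid as SetoidReasoning

module DigitExpansions {c ℓ : Level} (𝓔 : CommutativeRing c ℓ) where
  open CommutativeRing 𝓔 hiding (zero)
  open DigitSystems 𝓔
  open SetoidReasoning setoid
  open AbelianGroupProperties +-abelianGroup using (⁻¹-∙-comm; ⁻¹-anti-homo‿-; ε⁻¹≈ε)
  open CommutativeSemigroupProperties +-commutativeSemigroup using (interchange)
  open RingProperties ring using (-‿distribˡ-*)

  -- Differences telescope; this is transitivity of congruences.
  telescope : ∀ a b d → (a + - b) + (b + - d) ≈ a + - d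
  telescope a b d = begin
    (a + - b) + (b + - d)  ≈⟨ +-assoc a (- b) (b + - d) ⟩
    a + (- b + (b + - d))  ≈⟨ +-congˡ (+-assoc (- b) b (- d)) ⟨
    a + ((- b + b) + - d)  ≈⟨ +-congˡ (+-congʳ (-‿inverseˡ b)) ⟩
    a + (0# + - d)         ≈⟨ +-congˡ (+-identityˡ (- d)) ⟩
    a + - d                ∎

  cancel-common : ∀ d s t → (d + s) + - (d + t) ≈ s + - t
  cancel-common d s t = begin
    (d + s) + - (d + t)    ≈⟨ +-congˡ (⁻¹-∙-comm d t) ⟨
    (d + s) + (- d + - t)  ≈⟨ interchange d s (- d) (- t) ⟩
    (d + - d) + (s + - t)  ≈⟨ +-congʳ (-‿inverseʳ d) ⟩
    0# + (s + - t)         ≈⟨ +-identityˡ (s + - t) ⟩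
    s + - t                ∎

  sub-sub : ∀ a d t → (a + - d) + - t ≈ a + - (d + t)
  sub-sub a d t = begin
    (a + - d) + - t  ≈⟨ +-assoc a (- d) (- t) ⟩
    a + (- d + - t)  ≈⟨ +-congˡ (⁻¹-∙-comm d t) ⟩
    a + - (d + t)    ∎

  coeff : Poly → ℕ → Carrier
  coeff []      n       = 0#
  coeff (a ∷ p) zero    = a
  coeff (a ∷ p) (suc n) = coeff p n

  ≈ₚ⇒coeff : ∀ p q → p ≈ₚ q → ∀ n → coeff p n ≈ coeff q n
  ≈ₚ⇒coeff []      []      _       n       = refl
  ≈ₚ⇒coeff []      (b ∷ q) (e , r) zero    = sym e
  ≈ₚ⇒coeff []      (b ∷ q) (e , r) (suc n) = ≈ₚ⇒coeff [] q r n
  ≈ₚ⇒coeff (a ∷ p) []      (e , r) zero    = e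
  ≈ₚ⇒coeff (a ∷ p) []      (e , r) (suc n) = ≈ₚ⇒coeff p [] r n
  ≈ₚ⇒coeff (a ∷ p) (b ∷ q) (e , r) zero    = e
  ≈ₚ⇒coeff (a ∷ p) (b ∷ q) (e , r) (suc n) = ≈ₚ⇒coeff p q r n

  coeff⇒≈ₚ : ∀ p q → (∀ n → coeff p n ≈ coeff q n) → p ≈ₚ q
  coeff⇒≈ₚ []      []      h = tt
  coeff⇒≈ₚ []      (b ∷ q) h = sym (h zero) , coeff⇒≈ₚ [] q (h ∘ suc)
  coeff⇒≈ₚ (a ∷ p) []      h = h zero , coeff⇒≈ₚ p [] (h ∘ suc)
  coeff⇒≈ₚ (a ∷ p) (b ∷ q) h = h zero , coeff⇒≈ₚ p q (h ∘ suc)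

  coeff-+ : ∀ p q n → coeff (p +ₚ q) n ≈ coeff p n + coeff q n
  coeff-+ []      q       n       = sym (+-identityˡ _)
  coeff-+ (a ∷ p) []      n       = sym (+-identityʳ _)
  coeff-+ (a ∷ p) (b ∷ q) zero    = refl
  coeff-+ (a ∷ p) (b ∷ q) (suc n) = coeff-+ p q n

  coeff-neg : ∀ p n → coeff (-ₚ p) n ≈ - coeff p n
  coeff-neg []      n       = sym ε⁻¹≈ε
  coeff-neg (a ∷ p) zero    = refl
  coeff-neg (a ∷ p) (suc n) = coeff-neg p n

  coeff-sub : ∀ p q n → coeff (p -ₚ q) n ≈ coeff p n + - coeff q n
  coeff-sub p q n = trans (coeff-+ p (-ₚ q) n) (+-congˡ (coeff-neg q n))

  coeff-scale : ∀ a p n → coeff (map (a *_) p) n ≈ a * coeff p n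
  coeff-scale a []      n       = sym (zeroʳ a)
  coeff-scale a (b ∷ p) zero    = refl
  coeff-scale a (b ∷ p) (suc n) = coeff-scale a p n

  coeff-∷-* : ∀ a Q R n → coeff ((a ∷ Q) *ₚ R) n ≈ a * coeff R n + coeff (0# ∷ (Q *ₚ R)) n
  coeff-∷-* a Q R n = trans (coeff-+ (map (a *_) R) (0# ∷ (Q *ₚ R)) n) (+-congʳ (coeff-scale a R n))

  coeff-0∷-+ : ∀ A B C → (∀ m → coeff A m ≈ coeff B m + coeff C m) →
               ∀ n → coeff (0# ∷ A) n ≈ coeff (0# ∷ B) n + coeff (0# ∷ C) n
  coeff-0∷-+ A B C h zero    = sym (+-identityˡ 0#)
  coeff-0∷-+ A B C h (suc m) = h m

  coeff-0∷-neg : ∀ A B → (∀ m → coeff A m ≈ - coeff B m) →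
                 ∀ n → coeff (0# ∷ A) n ≈ - coeff (0# ∷ B) n
  coeff-0∷-neg A B h zero    = sym ε⁻¹≈ε
  coeff-0∷-neg A B h (suc m) = h m

  coeff-*-+ : ∀ Q₁ Q₂ R n → coeff ((Q₁ +ₚ Q₂) *ₚ R) n ≈ coeff (Q₁ *ₚ R) n + coeff (Q₂ *ₚ R) n
  coeff-*-+ []       Q₂       R n = sym (+-identityˡ _)
  coeff-*-+ (a ∷ Q₁) []       R n = sym (+-identityʳ _)
  coeff-*-+ (a ∷ Q₁) (b ∷ Q₂) R n = begin
    coeff (((a + b) ∷ (Q₁ +ₚ Q₂)) *ₚ R) n
      ≈⟨ coeff-∷-* (a + b) (Q₁ +ₚ Q₂) R n ⟩
    (a + b) * r + coeff (0# ∷ ((Q₁ +ₚ Q₂) *ₚ R)) n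
      ≈⟨ +-cong (distribʳ r a b)
                (coeff-0∷-+ ((Q₁ +ₚ Q₂) *ₚ R) (Q₁ *ₚ R) (Q₂ *ₚ R) (coeff-*-+ Q₁ Q₂ R) n) ⟩
    (a * r + b * r) + (coeff (0# ∷ (Q₁ *ₚ R)) n + coeff (0# ∷ (Q₂ *ₚ R)) n)
      ≈⟨ interchange _ _ _ _ ⟩
    (a * r + coeff (0# ∷ (Q₁ *ₚ R)) n) + (b * r + coeff (0# ∷ (Q₂ *ₚ R)) n)
      ≈⟨ +-cong (coeff-∷-* a Q₁ R n) (coeff-∷-* b Q₂ R n) ⟨
    coeff ((a ∷ Q₁) *ₚ R) n + coeff ((b ∷ Q₂) *ₚ R) n
      ∎
    where r = coeff R n

  coeff-*-neg : ∀ Q R n → coeff ((-ₚ Q) *ₚ R) n ≈ - coeff (Q *ₚ R) n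
  coeff-*-neg []      R n = sym ε⁻¹≈ε
  coeff-*-neg (a ∷ Q) R n = begin
    coeff ((- a ∷ -ₚ Q) *ₚ R) n
      ≈⟨ coeff-∷-* (- a) (-ₚ Q) R n ⟩
    - a * r + coeff (0# ∷ ((-ₚ Q) *ₚ R)) n
      ≈⟨ +-cong (sym (-‿distribˡ-* a r))
                (coeff-0∷-neg ((-ₚ Q) *ₚ R) (Q *ₚ R) (coeff-*-neg Q R) n) ⟩
    - (a * r) + - coeff (0# ∷ (Q *ₚ R)) n
      ≈⟨ ⁻¹-∙-comm _ _ ⟩
    - (a * r + coeff (0# ∷ (Q *ₚ R)) n)
      ≈⟨ -‿cong (coeff-∷-* a Q R n) ⟨
    - coeff ((a ∷ Q) *ₚ R) n
      ∎
    where r = coeff R n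

  coeff-0∷-* : ∀ Q R n → coeff ((0# ∷ Q) *ₚ R) n ≈ coeff (0# ∷ (Q *ₚ R)) n
  coeff-0∷-* Q R n = trans (coeff-∷-* 0# Q R n) (trans (+-congʳ (zeroˡ _)) (+-identityˡ _))

  coeff-1* : ∀ A n → coeff ((1# ∷ []) *ₚ A) n ≈ coeff A n
  coeff-1* A n = begin
    coeff ((1# ∷ []) *ₚ A) n          ≈⟨ coeff-∷-* 1# [] A n ⟩
    1# * coeff A n + coeff (0# ∷ []) n ≈⟨ +-cong (*-identityˡ _) (coeff-zero n) ⟩
    coeff A n + 0#                     ≈⟨ +-identityʳ _ ⟩
    coeff A n                          ∎
    where
    coeff-zero : ∀ n → coeff (0# ∷ []) n ≈ 0#
    coeff-zero zero    = refl
    coeff-zero (suc n) = refl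

  coeff-x* : ∀ A n → coeff (xₚ *ₚ A) n ≈ coeff (0# ∷ A) n
  coeff-x* A zero    = coeff-0∷-* (1# ∷ []) A zero
  coeff-x* A (suc n) = trans (coeff-0∷-* (1# ∷ []) A (suc n)) (coeff-1* A n)

  Multiple : Poly → (ℕ → Carrier) → Set (c ⊔ ℓ)
  Multiple M f = ∃[ Q ] (∀ n → f n ≈ coeff (Q *ₚ M) n)

  shift : (ℕ → Carrier) → ℕ → Carrier
  shift f zero    = 0#
  shift f (suc n) = f n

  module _ {M : Poly} where

    multiple-resp : ∀ {f g} → (∀ n → f n ≈ g n) → Multiple M f → Multiple M g
    multiple-resp f≈g (Q , h) = Q , λ n → trans (sym (f≈g n)) (h n)

    multiple-+ : ∀ {f g} → Multiple M f → Multiple M g → Multiple M (λ n → f n + g n)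
    multiple-+ (Q₁ , h₁) (Q₂ , h₂) =
      Q₁ +ₚ Q₂ , λ n → trans (+-cong (h₁ n) (h₂ n)) (sym (coeff-*-+ Q₁ Q₂ M n))

    multiple-neg : ∀ {f} → Multiple M f → Multiple M (λ n → - f n)
    multiple-neg (Q , h) = -ₚ Q , λ n → trans (-‿cong (h n)) (sym (coeff-*-neg Q M n))

    multiple-shift : ∀ {f} → Multiple M f → Multiple M (shift f)
    multiple-shift {f} (Q , h) = 0# ∷ Q , shifted
      where
      shifted : ∀ n → shift f n ≈ coeff ((0# ∷ Q) *ₚ M) n
      shifted zero    = sym (coeff-0∷-* Q M zero)
      shifted (suc n) = trans (h n) (sym (coeff-0∷-* Q M (suc n)))

  module Congruence (p₀ : Carrier) (mid : List Carrier) (p_d : Carrier) where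
    open Over p₀ mid p_d

    difference : Poly → Poly → ℕ → Carrier
    difference A B n = coeff A n + - coeff B n

    multiple⇒≈ᵣ : ∀ A B → Multiple P (difference A B) → A ≈ᵣ B
    multiple⇒≈ᵣ A B (Q , h) =
      Q , coeff⇒≈ₚ (A -ₚ B) (Q *ₚ P) (λ n → trans (coeff-sub A B n) (h n))

    ≈ᵣ⇒multiple : ∀ A B → A ≈ᵣ B → Multiple P (difference A B)
    ≈ᵣ⇒multiple A B (Q , e) =
      Q , λ n → trans (sym (coeff-sub A B n)) (≈ₚ⇒coeff (A -ₚ B) (Q *ₚ P) e n)

    ≈ᵣ-sym : ∀ A B → A ≈ᵣ B → B ≈ᵣ A
    ≈ᵣ-sym A B A≈B = multiple⇒≈ᵣ B A
      (multiple-resp (λ n → ⁻¹-anti-homo‿- (coeff A n) (coeff B n))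
                     (multiple-neg (≈ᵣ⇒multiple A B A≈B)))

    ≈ᵣ-trans : ∀ A B C → A ≈ᵣ B → B ≈ᵣ C → A ≈ᵣ C
    ≈ᵣ-trans A B C A≈B B≈C = multiple⇒≈ᵣ A C
      (multiple-resp (λ n → telescope (coeff A n) (coeff B n) (coeff C n))
                     (multiple-+ (≈ᵣ⇒multiple A B A≈B) (≈ᵣ⇒multiple B C B≈C)))

    horner-cong : ∀ D S S′ → S ≈ᵣ S′ → (D +ₚ (X *ₚ S)) ≈ᵣ (D +ₚ (X *ₚ S′))
    horner-cong D S S′ S≈S′ =
      multiple⇒≈ᵣ (D +ₚ (X *ₚ S)) (D +ₚ (X *ₚ S′))
        (multiple-resp shifted (multiple-shift (≈ᵣ⇒multiple S S′ S≈S′)))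
      where
      shifted-difference : ∀ n → shift (difference S S′) n ≈ difference (0# ∷ S) (0# ∷ S′) n
      shifted-difference zero    = sym (-‿inverseʳ 0#)
      shifted-difference (suc n) = refl

      shifted : ∀ n → shift (difference S S′) n ≈ difference (D +ₚ (X *ₚ S)) (D +ₚ (X *ₚ S′)) n
      shifted n = begin
        shift (difference S S′) n
          ≈⟨ shifted-difference n ⟩
        coeff (0# ∷ S) n + - coeff (0# ∷ S′) n
          ≈⟨ cancel-common (coeff D n) _ _ ⟨
        (coeff D n + coeff (0# ∷ S) n) + - (coeff D n + coeff (0# ∷ S′) n)
          ≈⟨ +-cong (+-congˡ (coeff-x* S n)) (-‿cong (+-congˡ (coeff-x* S′ n))) ⟨
        (coeff D n + coeff (X *ₚ S) n) + - (coeff D n + coeff (X *ₚ S′) n)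
          ≈⟨ +-cong (coeff-+ D (X *ₚ S) n) (-‿cong (coeff-+ D (X *ₚ S′) n)) ⟨
        difference (D +ₚ (X *ₚ S)) (D +ₚ (X *ₚ S′)) n
          ∎

    division-step : ∀ A e B → (X *ₚ B) ≈ᵣ (A -ₚ e) → A ≈ᵣ (e +ₚ (X *ₚ B))
    division-step A e B XB≈A-e =
      multiple⇒≈ᵣ A (e +ₚ (X *ₚ B))
        (multiple-resp rearrange (multiple-neg (≈ᵣ⇒multiple (X *ₚ B) (A -ₚ e) XB≈A-e)))
      where
      rearrange : ∀ n → - difference (X *ₚ B) (A -ₚ e) n ≈ difference A (e +ₚ (X *ₚ B)) n
      rearrange n = begin
        - (t + - coeff (A -ₚ e) n)     ≈⟨ -‿cong (+-congˡ (-‿cong (coeff-sub A e n))) ⟩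
        - (t + - (a + - coeff e n))    ≈⟨ ⁻¹-anti-homo‿- t (a + - coeff e n) ⟩
        (a + - coeff e n) + - t        ≈⟨ sub-sub a (coeff e n) t ⟩
        a + - (coeff e n + t)          ≈⟨ +-congˡ (-‿cong (coeff-+ e (X *ₚ B) n)) ⟨
        difference A (e +ₚ (X *ₚ B)) n ∎
        where
        a = coeff A n
        t = coeff (X *ₚ B) n

    module Expansion {𝓝 : Poly → Set (c ⊔ ℓ)} (ds : IsDigitSet 𝓝) where
      open IsDigitSet ds

      digits : ℕ → Poly → List Poly
      digits zero    A = []
      digits (suc n) A = D A ∷ digits n (T A)

      digits-in-𝓝 : ∀ n A → All 𝓝 (digits n A)
      digits-in-𝓝 zero    A = []
      digits-in-𝓝 (suc n) A = proj₁ (proj₂ (digit A)) ∷ digits-in-𝓝 n (T A)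

      digit-step : ∀ A → A ≈ᵣ (D A +ₚ (X *ₚ T A))
      digit-step A = division-step A (D A) (T A) (proj₂ (proj₂ (proj₂ (digit A))))

      finite-expansion : ∀ n A → Tⁿ n A ≈ᵣ [] → A ≈ᵣ evalDigits (digits n A)
      finite-expansion zero    A Tⁿ≈0 = Tⁿ≈0
      finite-expansion (suc n) A Tⁿ≈0 =
        ≈ᵣ-trans A (D A +ₚ (X *ₚ T A)) (evalDigits (digits (suc n) A))
          (digit-step A)
          (horner-cong (D A) (T A) (evalDigits (digits n (T A))) (finite-expansion n (T A) Tⁿ≈0))

lemma2p8 : {c ℓ : Level} (𝓔 : CommutativeRing c ℓ) →
    (p₀ : CommutativeRing.Carrier 𝓔) (mid : List (CommutativeRing.Carrier 𝓔))
    (p_d : CommutativeRing.Carrier 𝓔) →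
    DigitSystems.NonZeroDivisor 𝓔 p_d → DigitSystems.NonZeroDivisor 𝓔 p₀ →
    DigitSystems.FiniteQuotient 𝓔 p₀ →
    (𝓝 : DigitSystems.Poly 𝓔 → Set (c ⊔ ℓ)) →
    (ds : DigitSystems.Over.IsDigitSet 𝓔 p₀ mid p_d 𝓝) →
    DigitSystems.Over.FEP 𝓔 p₀ mid p_d ds →
    DigitSystems.Over.HasZeroCycle 𝓔 p₀ mid p_d 𝓝
lemma2p8 𝓔 p₀ mid p_d _ _ _ 𝓝 ds fep =
  -- The expansion of 0 obtained from n + 1 digit steps, where Tⁿ(T(0)) = 0.
  D [] , digits n (T []) , digits-in-𝓝 (suc n) [] ,
  ≈ᵣ-sym [] (evalDigits (digits (suc n) [])) (finite-expansion (suc n) [] Tⁿ⁺¹0≈0)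
  where
  open DigitExpansions 𝓔
  open Congruence p₀ mid p_d
  open Expansion ds
  open DigitSystems.Over 𝓔 p₀ mid p_d using (_≈ᵣ_; evalDigits)
  open DigitSystems.Over.IsDigitSet ds using (D; T; Tⁿ)

  n : ℕ
  n = proj₁ (fep (T []))

  Tⁿ⁺¹0≈0 : Tⁿ n (T []) ≈ᵣ []
  Tⁿ⁺¹0≈0 = proj₂ (fep (T []))
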